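{- For every ternary signed-digit encoding $\alpha:\mathbb{N}\to\{\bar 1,0,1\}$, we have $\langle\!\langle \mathrm{neg}(\alpha)\rangle\!\rangle = -\langle\!\langle\alpha\rangle\!\rangle$ in the interval object $\mathbb{I}$; i.e. $\mathrm{neg}$ realises negation on the interval object.
   Context: Work in constructive type theory with function extensionality. An interval object is a set $\mathbb{I}$ with a binary operation $\oplus$, a map $M:\mathbb{I}^{\mathbb{N}}\to\mathbb{I}$ and points $-1,+1\in\mathbb{I}$ such that: $\oplus$ is idempotent, commutative, transpositional ($(a\oplus b)\oplus(c\oplus d)=(a\oplus c)\oplus(b\oplus d)$) and cancellative ($a\oplus c=b\oplus c\Rightarrow a=b$); $M(\alpha)=\alpha_0\oplus M(\mathrm{tail}\,\alpha)$ for all $\alpha$; for all $\alpha,\beta:\mathbb{N}\to\mathbb{I}$, if $\beta_i=\alpha_i\oplus\beta_{i+1}$ for all $i$ then $\beta_0=M(\alpha)$; and (universal property) for every set $B$ with $\oplus_B$, $M_B$, $s,t\in B$ satisfying all the preceding conditions, there is a unique $h:\mathbb{I}\to B$ with $h(-1)=s$, $h(+1)=t$ and $h(a\oplus b)=h(a)\oplus_B h(b)$. Fix such an interval object. $0:=-1\oplus+1$. Negation $-:\mathbb{I}\to\mathbb{I}$ is the unique map with $-(-1)=+1$, $-(+1)=-1$, $-(a\oplus b)=(-a)\oplus(-b)$. Ternary digits are $\{\bar1,0,1\}$ with $\langle\bar1\rangle=-1$, $\langle0\rangle=0$, $\langle1\rangle=+1$; for $\alpha:\mathbb{N}\to\{\bar1,0,1\}$,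 $\langle\!\langle\alpha\rangle\!\rangle:=M(n\mapsto\langle\alpha_n\rangle)$. $\mathrm{flip}$ swaps $\bar1$ and $1$ and fixes $0$, and $\mathrm{neg}(\alpha)_n:=\mathrm{flip}(\alpha_n)$. -}

module Defs where

open import Data.Nat using (ℕ; zero; suc)
open import Data.Product using (Σ; _×_; _,_; proj₁)
open import Relation.Binary.PropositionalEquality using (_≡_)

tail : {A : Set} → (ℕ → A) → (ℕ → A)
tail α n = α (suc n)

-- Sets are types in Set; equality is propositional equality
-- (function extensionality is available in the ambient theory of the paper).
record IsConvexBody (B : Set) (_⊕_ : B → B → B) (M : (ℕ → B) → B) : Set where
  field
    idem   : ∀ a → a ⊕ a ≡ a
    comm   : ∀ a b → a ⊕ b ≡ b ⊕ a
    transp : ∀ a b c d → (a ⊕ b) ⊕ (c ⊕ d) ≡ (a ⊕ c) ⊕ (b ⊕ d)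
    cancel : ∀ a b c → a ⊕ c ≡ b ⊕ c → a ≡ b
    M-prop₁ : ∀ (α : ℕ → B) → M α ≡ α 0 ⊕ M (tail α)
    M-prop₂ : ∀ (α β : ℕ → B) → (∀ i → β i ≡ α i ⊕ β (suc i)) → β 0 ≡ M α

IsAffineHom : {A B : Set} (_⊕A_ : A → A → A) (_⊕B_ : B → B → B)
              (u v : A) (s t : B) (h : A → B) → Set
IsAffineHom _⊕A_ _⊕B_ u v s t h =
  (h u ≡ s) × (h v ≡ t) × (∀ a b → h (a ⊕A b) ≡ h a ⊕B h b)

record IntervalObject : Set₁ where
  field
    𝕀   : Set
    _⊕_ : 𝕀 → 𝕀 → 𝕀
    M   : (ℕ → 𝕀) → 𝕀
    −1 +1 : 𝕀
    isConvexBody : IsConvexBody 𝕀 _⊕_ M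
    universal : (B : Set) (_⊕B_ : B → B → B) (MB : (ℕ → B) → B)
                → IsConvexBody B _⊕B_ MB → (s t : B)
                → Σ (𝕀 → B) λ h → IsAffineHom _⊕_ _⊕B_ −1 +1 s t h
                     × (∀ (g : 𝕀 → B) → IsAffineHom _⊕_ _⊕B_ −1 +1 s t g
                          → ∀ x → g x ≡ h x)

  0ᴵ : 𝕀
  0ᴵ = −1 ⊕ +1

  neg𝕀 : 𝕀 → 𝕀
  neg𝕀 = proj₁ (universal 𝕀 _⊕_ M isConvexBody +1 −1)

data 𝟛 : Set where
  1̄ 0d 1d : 𝟛

flip : 𝟛 → 𝟛
flip 1̄ = 1d
flip 0d = 0d
flip 1d = 1̄

neg : (ℕ → 𝟛) → (ℕ → 𝟛)
neg α n = flip (α n)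

module _ (IO : IntervalObject) where
  open IntervalObject IO

  ⟨_⟩ : 𝟛 → 𝕀
  ⟨ 1̄ ⟩ = −1
  ⟨ 0d ⟩ = 0ᴵ
  ⟨ 1d ⟩ = +1

  ⟪_⟫ : (ℕ → 𝟛) → 𝕀
  ⟪ α ⟫ = M (λ n → ⟨ α n ⟩)

-- A ⊕-homomorphism h preserves M: the sequence βᵢ = h (M (αᵢ, αᵢ₊₁, …)) satisfies
-- βᵢ = h αᵢ ⊕ βᵢ₊₁ by the unfolding equation, so the canonicity axiom of the target
-- identifies β₀ with M (h ∘ α). Negation is such a homomorphism and sends each digit
-- ⟨d⟩ to ⟨flip d⟩, whence ⟪neg α⟫ = -⟪α⟫.
module Submission where

open import Defs
open import Data.Nat using (ℕ; zero; suc)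
open import Data.Product using (proj₁; proj₂)
open import Relation.Binary.PropositionalEquality
  using (_≡_; refl; sym; trans; cong; cong₂; module ≡-Reasoning)

drop : {A : Set} → ℕ → (ℕ → A) → (ℕ → A)
drop zero    α = α
drop (suc i) α = drop i (tail α)

drop-head : {A : Set} (i : ℕ) (α : ℕ → A) → drop i α 0 ≡ α i
drop-head zero    α = refl
drop-head (suc i) α = drop-head i (tail α)

tail-drop : {A : Set} (i : ℕ) (α : ℕ → A) → tail (drop i α) ≡ drop (suc i) α
tail-drop zero    α = refl
tail-drop (suc i) α = tail-drop i (tail α)

-- The hypothesis relating γ to h ∘ α pointwise replaces function extensionality.
hom-preserves-M :
  {A B : Set} {_⊕A_ : A → A → A} {_⊕B_ : B → B → B}
  {MA : (ℕ → A) → A} {MB : (ℕ → B) → B}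
  → IsConvexBody A _⊕A_ MA → IsConvexBody B _⊕B_ MB
  → (h : A → B) → (∀ a b → h (a ⊕A b) ≡ h a ⊕B h b)
  → (α : ℕ → A) (γ : ℕ → B) → (∀ n → h (α n) ≡ γ n)
  → h (MA α) ≡ MB γ
hom-preserves-M {B = B} {_⊕A_ = _⊕A_} {_⊕B_} {MA} {MB} A-convex B-convex h h-⊕ α γ hα≡γ =
  IsConvexBody.M-prop₂ B-convex γ β β-unfold
  where
  β : ℕ → B
  β i = h (MA (drop i α))

  β-unfold : ∀ i → β i ≡ γ i ⊕B β (suc i)
  β-unfold i = begin
    h (MA (drop i α))                              ≡⟨ cong h (IsConvexBody.M-prop₁ A-convex (drop i α)) ⟩
    h (drop i α 0 ⊕A MA (tail (drop i α)))         ≡⟨ h-⊕ _ _ ⟩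
    h (drop i α 0) ⊕B h (MA (tail (drop i α)))     ≡⟨ cong₂ _⊕B_ (trans (cong h (drop-head i α)) (hα≡γ i))
                                                                  (cong (λ δ → h (MA δ)) (tail-drop i α)) ⟩
    γ i ⊕B β (suc i)                               ∎
    where open ≡-Reasoning

module _ (IO : IntervalObject) where
  open IntervalObject IO
  open IsConvexBody isConvexBody

  neg𝕀-isAffineHom : IsAffineHom _⊕_ _⊕_ −1 +1 +1 −1 neg𝕀
  neg𝕀-isAffineHom = proj₁ (proj₂ (universal 𝕀 _⊕_ M isConvexBody +1 −1))

  neg𝕀-−1 : neg𝕀 −1 ≡ +1
  neg𝕀-−1 = proj₁ neg𝕀-isAffineHom

  neg𝕀-+1 : neg𝕀 +1 ≡ −1
  neg𝕀-+1 = proj₁ (proj₂ neg𝕀-isAffineHom)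

  neg𝕀-⊕ : ∀ a b → neg𝕀 (a ⊕ b) ≡ neg𝕀 a ⊕ neg𝕀 b
  neg𝕀-⊕ = proj₂ (proj₂ neg𝕀-isAffineHom)

  neg𝕀-digit : ∀ d → neg𝕀 (⟨_⟩ IO d) ≡ ⟨_⟩ IO (flip d)
  neg𝕀-digit 1̄  = neg𝕀-−1
  neg𝕀-digit 1d = neg𝕀-+1
  neg𝕀-digit 0d = begin
    neg𝕀 (−1 ⊕ +1)       ≡⟨ neg𝕀-⊕ −1 +1 ⟩
    neg𝕀 −1 ⊕ neg𝕀 +1    ≡⟨ cong₂ _⊕_ neg𝕀-−1 neg𝕀-+1 ⟩
    +1 ⊕ −1              ≡⟨ comm +1 −1 ⟩
    −1 ⊕ +1              ∎
    where open ≡-Reasoning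

theorem5p56 : (IO : IntervalObject) (α : ℕ → 𝟛)
    → ⟪_⟫ IO (neg α) ≡ IntervalObject.neg𝕀 IO (⟪_⟫ IO α)
theorem5p56 IO α =
  sym (hom-preserves-M isConvexBody isConvexBody neg𝕀 (neg𝕀-⊕ IO)
         (λ n → ⟨_⟩ IO (α n)) (λ n → ⟨_⟩ IO (flip (α n))) (λ n → neg𝕀-digit IO (α n)))
  where open IntervalObject IO
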